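{- Let $H$ be a $3$-hypergraph, $\pi$ a quasigraph in $H$, and $Y\subseteq X\subseteq V(H)$. Suppose $e$ is a hyperedge of $H$ with $\pi(e)\subseteq Y$, and let $\sigma=\pi-e$. Then: (i) if $\pi$ is anticonnected on $X$, then so is $\sigma$; (ii) if $\pi$ is connected on $X$ and $\sigma$ is connected on $Y$, then $\sigma$ is connected on $X$.
   Context: A $3$-hypergraph is a finite hypergraph all of whose hyperedges have size $2$ or $3$. A quasigraph $\pi$ in $H$ is a map assigning to each hyperedge $e$ either a $2$-element subset of $e$ or $\emptyset$; $e$ is used by $\pi$ if $\pi(e)\neq\emptyset$. $\pi-e$ is the quasigraph with value $\emptyset$ on $e$ and equal to $\pi$ elsewhere. $\pi^*$ denotes the graph on $V(H)$ whose edges are the pairs $\pi(e)$ for used hyperedges $e$. $\pi$ is connected on $X$ if the subgraph of $\pi^*$ induced on $X$ is connected. $\pi$ is anticonnected on $X$ if for every partition $\mathcal R$ of $X$ with at least two classes there is a hyperedge $f$ of $H$ intersecting at least two classes of $\mathcal R$ such that $\pi(f)$ is a subset of one class of $\mathcal R$ (possibly $\pi(f)=\emptyset$). -}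

module Defs where

open import Data.Nat using (ℕ; _≡ᵇ_)
open import Data.Fin using (Fin; _≟_)
open import Data.Fin.Subset using (Subset; _∈_; _⊆_; ∣_∣; ⊥)
open import Data.Fin.Subset.Properties using (⊥⊆)
open import Data.Product using (Σ; ∃; ∃-syntax; _×_; _,_)
open import Data.Sum using (_⊎_)
open import Relation.Binary.PropositionalEquality using (_≡_; _≢_)
open import Relation.Nullary using (¬_; yes; no)

-- A 3-hypergraph on vertex set Fin n with m hyperedges (indexed by Fin m,
-- so parallel hyperedges are allowed); every hyperedge has size 2 or 3.
record Hypergraph3 (n m : ℕ) : Set where
  field
    edge : Fin m → Subset n
    edge-size : ∀ i → ∣ edge i ∣ ≡ 2 ⊎ ∣ edge i ∣ ≡ 3

open Hypergraph3 public

record Quasigraph {n m : ℕ} (H : Hypergraph3 n m) : Set where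
  field
    val : Fin m → Subset n
    val-⊆ : ∀ i → val i ⊆ edge H i
    val-size : ∀ i → ∣ val i ∣ ≡ 2 ⊎ val i ≡ ⊥

open Quasigraph public

minus : ∀ {n m} {H : Hypergraph3 n m} → Quasigraph H → Fin m → Quasigraph H
val (minus π e) i with i ≟ e
... | yes _ = ⊥
... | no _ = val π i
val-⊆ (minus π e) i with i ≟ e
... | yes _ = ⊥⊆
... | no _ = val-⊆ π i
val-size (minus π e) i with i ≟ e
... | yes _ = _⊎_.inj₂ _≡_.refl
... | no _ = val-size π i

-- Edges of π* : u v adjacent iff {u,v} = π(f) for some used hyperedge f.
-- Since used values have exactly 2 elements, this means u ≠ v and u, v ∈ π(f).
Adj : ∀ {n m} {H : Hypergraph3 n m} → Quasigraph H → Fin n → Fin n → Set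
Adj {m = m} π u v = u ≢ v × ∃[ f ] (u ∈ val π f × v ∈ val π f)

data Reach {n m} {H : Hypergraph3 n m} (π : Quasigraph H) (X : Subset n)
     : Fin n → Fin n → Set where
  here : ∀ {u} → u ∈ X → Reach π X u u
  step : ∀ {u w v} → Reach π X u w → Adj π w v → v ∈ X → Reach π X u v

Connected : ∀ {n m} {H : Hypergraph3 n m} → Quasigraph H → Subset n → Set
Connected π X = ∀ u v → u ∈ X → v ∈ X → Reach π X u v

-- A partition R of X is encoded by a class-labelling c (the classes are the
-- nonempty fibres of c restricted to X; values outside X are irrelevant).
TwoClasses : ∀ {n} → Subset n → (Fin n → ℕ) → Set
TwoClasses X c = ∃[ u ] ∃[ v ] (u ∈ X × v ∈ X × c u ≢ c v)

Anticonnected : ∀ {n m} {H : Hypergraph3 n m} → Quasigraph H → Subset n → Set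
Anticonnected {H = H} π X =
  (c : Fin _ → ℕ) → TwoClasses X c →
  ∃[ f ] ( (∃[ u ] ∃[ v ] (u ∈ edge H f × v ∈ edge H f × u ∈ X × v ∈ X × c u ≢ c v))
         × (∃[ k ] (∀ w → w ∈ val π f → w ∈ X × c w ≡ k)) )

-- Deleting e only shrinks the values of π, so every hyperedge witnessing
-- anticonnectedness for π still witnesses it for π − e. For connectivity, take
-- a walk of π* inside X: a step along π(f) with f ≠ e is still an edge of
-- (π − e)*, while a step along π(e) joins two vertices of Y, which π − e
-- already connects inside Y ⊆ X.
module Submission where

open import Defs
open import Data.Fin using (Fin; _≟_)
open import Data.Fin.Subset using (Subset; _⊆_; _∈_)
open import Data.Fin.Subset.Properties using (∉⊥)
open import Data.Product using (_×_; _,_)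
open import Relation.Binary.PropositionalEquality using (refl; _≢_)
open import Relation.Nullary using (yes; no; contradiction)

_≤Q_ : ∀ {n m} {H : Hypergraph3 n m} → Quasigraph H → Quasigraph H → Set
σ ≤Q π = ∀ f → val σ f ⊆ val π f

module _ {n m} {H : Hypergraph3 n m} {π : Quasigraph H} {e : Fin m} where

  minus-≤Q : minus π e ≤Q π
  minus-≤Q f p with f ≟ e
  ... | yes _ = contradiction p ∉⊥
  ... | no _ = p

  val-minus-≢ : ∀ {f} → f ≢ e → val π f ⊆ val (minus π e) f
  val-minus-≢ {f} f≢e p with f ≟ e
  ... | yes f≡e = contradiction f≡e f≢e
  ... | no _ = p

Anticonnected-antimono : ∀ {n m} {H : Hypergraph3 n m} {σ π : Quasigraph H} {X : Subset n} →
                         σ ≤Q π → Anticonnected π X → Anticonnected σ X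
Anticonnected-antimono σ≤π A c twoClasses with A c twoClasses
... | f , crossing , k , monochromatic =
  f , crossing , k , λ w w∈σf → monochromatic w (σ≤π f w∈σf)

module _ {n m} {H : Hypergraph3 n m} {π : Quasigraph H} where

  Reach-trans : ∀ {X : Subset n} {u w v} → Reach π X u w → Reach π X w v → Reach π X u v
  Reach-trans r (here _) = r
  Reach-trans r (step r′ a v∈X) = step (Reach-trans r r′) a v∈X

  Reach-mono : ∀ {X Y : Subset n} {u v} → Y ⊆ X → Reach π Y u v → Reach π X u v
  Reach-mono Y⊆X (here u∈Y) = here (Y⊆X u∈Y)
  Reach-mono Y⊆X (step r a v∈Y) = step (Reach-mono Y⊆X r) a (Y⊆X v∈Y)

Reach-minus : ∀ {n m} {H : Hypergraph3 n m} {π : Quasigraph H} {X Y : Subset n} {e : Fin m} →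
              Y ⊆ X → val π e ⊆ Y → Connected (minus π e) Y →
              ∀ {u v} → Reach π X u v → Reach (minus π e) X u v
Reach-minus Y⊆X πe⊆Y connY (here u∈X) = here u∈X
Reach-minus {e = e} Y⊆X πe⊆Y connY (step {w = w} {v = v} r (w≢v , f , w∈πf , v∈πf) v∈X)
  with f ≟ e
... | yes refl = Reach-trans (Reach-minus Y⊆X πe⊆Y connY r)
                             (Reach-mono Y⊆X (connY w v (πe⊆Y w∈πf) (πe⊆Y v∈πf)))
... | no f≢e = step (Reach-minus Y⊆X πe⊆Y connY r)
                    (w≢v , f , val-minus-≢ f≢e w∈πf , val-minus-≢ f≢e v∈πf) v∈X

lemma5 : ∀ {n m} (H : Hypergraph3 n m) (π : Quasigraph H) (X Y : Subset n) →
         Y ⊆ X → (e : Fin m) → val π e ⊆ Y →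
         (Anticonnected π X → Anticonnected (minus π e) X) ×
         (Connected π X → Connected (minus π e) Y → Connected (minus π e) X)
lemma5 H π X Y Y⊆X e πe⊆Y =
    Anticonnected-antimono {σ = minus π e} {π = π} minus-≤Q
  , λ connX connY u v u∈X v∈X → Reach-minus Y⊆X πe⊆Y connY (connX u v u∈X v∈X)
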